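{- Let $K$ be an imaginary quadratic field of class number $1$ with $K\neq\mathbb Q(\sqrt{ -1}),\mathbb Q(\sqrt{ -2}),\mathbb Q(\sqrt{ -3})$, and let $p$ be a rational prime which splits in $K$ and satisfies $p\equiv1\bmod4$. If $K=\mathbb Q(\sqrt{ -7})$, then $p$ is a special split prime for $K$. If $K=\mathbb Q(\sqrt{ -q})$ with $q\in\{11,19,43,67,163\}$, then $p$ is a special split prime for $K$ if and only if one can write $p=\pi\pi^*$ in $\mathcal O_K$ with $\pi+\pi^*\equiv0\bmod2$.
   Context: A rational prime $p$ is a special split prime for $K$ if $p$ splits in $K$ and $p=\pi\pi^*$ with $\pi\in\mathcal O_K$, $\pi^*$ its complex conjugate, and $\pi\equiv1\bmod4$. -}

module Defs where

open import Data.Nat as ℕ using (ℕ)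
open import Data.Nat.DivMod using (_/_)
open import Data.Integer using (ℤ; +_; _+_; _-_; _*_; -_)
open import Data.Integer.Divisibility using (_∣_)
open import Data.Nat.Primality using (Prime)
open import Data.Product using (Σ; ∃; _×_; _,_)
open import Relation.Binary.PropositionalEquality using (_≡_)
open import Relation.Nullary using (¬_)

-- K = ℚ(√-d) with d ≡ 3 (mod 4) squarefree (here d ∈ {7,11,19,43,67,163}),
-- so O_K = ℤ[ω], ω = (1 + √-d)/2, with ω² = ω - c, c = (1+d)/4.
-- The element a + bω is represented by the pair (a , b).

cK : ℕ → ℤ
cK d = + ((1 ℕ.+ d) / 4)

record O : Set where
  constructor _+_ω
  field
    re : ℤ
    om : ℤ
open O public

ι : ℤ → O
ι n = n + + 0 ω

_⊕_ : O → O → O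
(a + b ω) ⊕ (a' + b' ω) = (a + a') + (b + b') ω

_⊖_ : O → O → O
(a + b ω) ⊖ (a' + b' ω) = (a - a') + (b - b') ω

mul : ℕ → O → O → O
mul d (a + b ω) (a' + b' ω) =
  ((a * a') - (cK d * (b * b'))) + ((a * b') + (a' * b) + (b * b')) ω

-- complex conjugation: ω* = 1 - ω
conj : O → O
conj (a + b ω) = (a + b) + (- b) ω

CongO : ℕ → O → O → O → Set
CongO d α β μ = ∃ λ γ → (α ⊖ β) ≡ mul d μ γ

-- p splits in K = ℚ(√-d) (O_K = ℤ[ω] monogenic, minimal polynomial of ω is
-- x² - x + c): by Dedekind–Kummer, p splits iff x² - x + c has two distinct
-- roots modulo p, i.e. some root x with p ∤ (2x - 1) (the derivative).
Splits : ℕ → ℕ → Set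
Splits d p = ∃ λ (x : ℤ) →
  ((+ p) ∣ ((x * x) - x + cK d)) × ¬ ((+ p) ∣ ((+ 2 * x) - + 1))

SpecialSplit : ℕ → ℕ → Set
SpecialSplit d p = Splits d p ×
  (∃ λ (π : O) → ι (+ p) ≡ mul d π (conj π) × CongO d π (ι (+ 1)) (ι (+ 4)))

{-# OPTIONS --safe #-}
module Submission where

-- In ℤ[ω] the norm is N(a + bω) = a² + ab + c b² with c = (1 + d)/4. If N(a + bω) = p ≡ 1
-- (mod 4) and b is even, reducing modulo 4 forces a odd and b ≡ 0 (mod 4), so one of ±(a + bω)
-- is ≡ 1 (mod 4); conversely π ≡ 1 (mod 4) has b ≡ 0 (mod 4). Since the trace 2a + b is even
-- exactly when b is, this proves the criterion for every d. For d = 7 a root x of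
-- x² − x + 2 modulo p gives the form (p, |2x − 1|, q) of discriminant −7 representing p;
-- Gauss reduction turns it into the only reduced form of that discriminant, the norm form
-- u² + uv + 2v², so p = N(π), and b is even because c = 2 is even and p is odd.
-- Neither the primality of p nor the particular value of q is needed.

open import Defs
open import Level using (0ℓ)
open import Data.Nat as ℕ using (ℕ; zero; suc; z≤n; s≤s; NonZero)
import Data.Nat.Properties as ℕ
open import Data.Nat.DivMod using (_%_; [m+kn]%n≡m%n; m*n%n≡0; m∣n⇒o%n%m≡o%m)
open import Data.Nat.Divisibility.Core using (divides)
open import Data.Integer as ℤ using (ℤ; +_; -[1+_]; _+_; _-_; _*_; -_; ∣_∣)
open import Data.Integer.DivMod using (_%ℕ_; _/ℕ_; n%ℕd<d; a≡a%ℕn+[a/ℕn]*n)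
import Data.Integer.Properties as ℤ
open import Data.Integer.Tactic.RingSolver using (solve-∀)
open import Data.List using (_∷_; [])
open import Data.List.Membership.Propositional using (_∈_)
open import Data.Nat.Primality using (Prime)
open import Data.Product using (Σ; ∃; ∃₂; _×_; _,_)
open import Data.Sum using (_⊎_; inj₁; inj₂)
open import Function.Bundles using (_⇔_; mk⇔)
open import Relation.Nullary using (yes; no; contradiction)
open import Relation.Unary using (Pred; _⊆_)
open import Relation.Binary.PropositionalEquality

-- Norms and congruences in ℤ[ω]

form : ℤ → ℤ → ℤ → ℤ → ℤ → ℤ
form a b c u v = a * (u * u) + b * (u * v) + c * (v * v)

norm : ℕ → O → ℤ
norm d (a + b ω) = form (+ 1) (+ 1) (cK d) a b

mul-conj : ∀ d π → mul d π (conj π) ≡ ι (norm d π)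
mul-conj d (a + b ω) = cong₂ _+_ω (re-identity a b (cK d)) (om-identity a b)
  where
  re-identity : ∀ a b k → a * (a + b) - k * (b * - b) ≡ + 1 * (a * a) + + 1 * (a * b) + k * (b * b)
  re-identity = solve-∀
  om-identity : ∀ a b → a * - b + (a + b) * b + b * - b ≡ + 0
  om-identity = solve-∀

norm⇒mul-conj : ∀ d p π → norm d π ≡ + p → ι (+ p) ≡ mul d π (conj π)
norm⇒mul-conj d p π n≡p = trans (cong ι (sym n≡p)) (sym (mul-conj d π))

mul-conj⇒norm : ∀ d p π → ι (+ p) ≡ mul d π (conj π) → norm d π ≡ + p
mul-conj⇒norm d p π p≡ = sym (cong re (trans p≡ (mul-conj d π)))

mul-ι : ∀ d m γ → mul d (ι m) γ ≡ (m * re γ) + (m * om γ) ω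
mul-ι d m (x + y ω) = cong₂ _+_ω (re-identity m x y (cK d)) (om-identity m x y)
  where
  re-identity : ∀ m x y k → m * x - k * (+ 0 * y) ≡ m * x
  re-identity = solve-∀
  om-identity : ∀ m x y → m * y + x * + 0 + + 0 * y ≡ m * y
  om-identity = solve-∀

congO-ι : ∀ d α β m x y → re α - re β ≡ m * x → om α - om β ≡ m * y → CongO d α β (ι m)
congO-ι d α β m x y re≡ om≡ = x + y ω , trans (cong₂ _+_ω re≡ om≡) (sym (mul-ι d m (x + y ω)))

congO-ι⁻¹ : ∀ d α β m → CongO d α β (ι m) →
            ∃₂ λ x y → re α - re β ≡ m * x × om α - om β ≡ m * y
congO-ι⁻¹ d α β m (γ , α⊖β≡) = re γ , om γ , cong re α⊖β≡′ , cong om α⊖β≡′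
  where α⊖β≡′ = trans α⊖β≡ (mul-ι d m γ)

norm-neg : ∀ d a b → norm d ((- a) + (- b) ω) ≡ norm d (a + b ω)
norm-neg d a b = identity a b (cK d)
  where
  identity : ∀ a b k → + 1 * (- a * - a) + + 1 * (- a * - b) + k * (- b * - b)
                     ≡ + 1 * (a * a) + + 1 * (a * b) + k * (b * b)
  identity = solve-∀

-- Binary quadratic forms of discriminant −D

pos-sq+ : ∀ m n → + (m ℕ.* m ℕ.+ n) ≡ + m * + m + + n
pos-sq+ m n = trans (ℤ.pos-+ (m ℕ.* m) n) (cong (_+ + n) (ℤ.pos-* m m))

abs-sq : ∀ i → + ∣ i ∣ * + ∣ i ∣ ≡ i * i
abs-sq (+ n) = refl
abs-sq -[1+ n ] = refl

nonneg-factor : ∀ {n} k x → + n ≡ + suc k * x → x ≡ + ∣ x ∣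
nonneg-factor k (+ m) _ = refl
nonneg-factor k -[1+ m ] ()

∣b-2a∣<b : ∀ {a b} → 0 ℕ.< a → a ℕ.< b → ∣ + b - (+ a + + a) ∣ ℕ.< b
∣b-2a∣<b {a} {b} 0<a a<b rewrite ℤ.m-n≡m⊖n b (a ℕ.+ a) with ℕ.≤-total (a ℕ.+ a) b
... | inj₁ 2a≤b = begin-strict
  ∣ b ℤ.⊖ (a ℕ.+ a) ∣   ≡⟨ ℤ.∣m⊖n∣≡∣n⊖m∣ b (a ℕ.+ a) ⟩
  ∣ (a ℕ.+ a) ℤ.⊖ b ∣   ≡⟨ ℤ.∣⊖∣-≤ 2a≤b ⟩
  b ℕ.∸ (a ℕ.+ a)       <⟨ ℕ.∸-monoʳ-< (ℕ.+-mono-< 0<a 0<a) 2a≤b ⟩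
  b                     ∎
  where open ℕ.≤-Reasoning
... | inj₂ b≤2a = begin-strict
  ∣ b ℤ.⊖ (a ℕ.+ a) ∣   ≡⟨ ℤ.∣⊖∣-≤ b≤2a ⟩
  (a ℕ.+ a) ℕ.∸ b       <⟨ ℕ.m<n+o⇒m∸n<o (a ℕ.+ a) b {{ℕ.>-nonZero (ℕ.<-trans 0<a a<b)}}
                             (ℕ.+-mono-< a<b a<b) ⟩
  b                     ∎
  where open ℕ.≤-Reasoning

form-abs-middle : ∀ a β c u v → ∃ λ v′ → form a β c u v ≡ form a (+ ∣ β ∣) c u v′
form-abs-middle a (+ n) c u v = v , refl
form-abs-middle a -[1+ n ] c u v = - v , identity a -[1+ n ] c u v
  where
  identity : ∀ a b c u v → a * (u * u) + b * (u * v) + c * (v * v)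
                         ≡ a * (u * u) + (- b) * (u * - v) + c * (- v * - v)
  identity = solve-∀

disc-shift : ∀ A B C D → B * B + D ≡ + 4 * (A * C) →
             (B - (A + A)) * (B - (A + A)) + D ≡ + 4 * (A * (A - B + C))
disc-shift A B C D disc = begin
  (B - (A + A)) * (B - (A + A)) + D     ≡⟨ expand A B D ⟩
  (B * B + D) + + 4 * (A * A - A * B)   ≡⟨ cong (_+ + 4 * (A * A - A * B)) disc ⟩
  + 4 * (A * C) + + 4 * (A * A - A * B) ≡⟨ collect A B C ⟩
  + 4 * (A * (A - B + C))               ∎
  where
  open ≡-Reasoning
  expand : ∀ A B D → (B - (A + A)) * (B - (A + A)) + D ≡ (B * B + D) + + 4 * (A * A - A * B)
  expand = solve-∀
  collect : ∀ A B C → + 4 * (A * C) + + 4 * (A * A - A * B) ≡ + 4 * (A * (A - B + C))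
  collect = solve-∀

form-shift : ∀ A B C u v → form A B C u v ≡ form A (B - (A + A)) (A - B + C) (u + v) v
form-shift = identity
  where
  identity : ∀ A B C u v → A * (u * u) + B * (u * v) + C * (v * v)
           ≡ A * ((u + v) * (u + v)) + (B - (A + A)) * ((u + v) * v) + (A - B + C) * (v * v)
  identity = solve-∀

-- a u² + b uv + c v² with b² − 4ac = −D; a negative middle coefficient is made positive by v ↦ −v.
record Form (D : ℕ) : Set where
  constructor mkForm
  field
    a b c : ℕ
    disc : + b * + b + + D ≡ + 4 * (+ a * + c)

module _ {D : ℕ} where

  values : Form D → Pred ℤ 0ℓ
  values (mkForm a b c _) n = ∃₂ λ u v → n ≡ form (+ a) (+ b) (+ c) u v

  Reduced : Form D → Set
  Reduced (mkForm a b c _) = b ℕ.≤ a × a ℕ.≤ c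

  size : Form D → ℕ
  size (mkForm a b c _) = a ℕ.+ b

  disc-ℕ : (f : Form D) → let open Form f in b ℕ.* b ℕ.+ D ≡ 4 ℕ.* (a ℕ.* c)
  disc-ℕ (mkForm a b c disc) = ℤ.+-injective (begin
    + (b ℕ.* b ℕ.+ D)     ≡⟨ pos-sq+ b D ⟩
    + b * + b + + D       ≡⟨ disc ⟩
    + 4 * (+ a * + c)     ≡⟨ cong (+ 4 *_) (ℤ.pos-* a c) ⟨
    + 4 * + (a ℕ.* c)     ≡⟨ ℤ.pos-* 4 (a ℕ.* c) ⟨
    + (4 ℕ.* (a ℕ.* c))   ∎)
    where open ≡-Reasoning

  swap : Form D → Form D
  swap (mkForm a b c disc) = mkForm c b a (trans disc (cong (+ 4 *_) (ℤ.*-comm (+ a) (+ c))))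

  values-swap : (f : Form D) → values f ⊆ values (swap f)
  values-swap (mkForm a b c _) (u , v , n≡) = v , u , trans n≡ (identity (+ a) (+ b) (+ c) u v)
    where
    identity : ∀ a b c u v → a * (u * u) + b * (u * v) + c * (v * v)
                           ≡ c * (v * v) + b * (v * u) + a * (u * u)
    identity = solve-∀

module _ {D : ℕ} .{{_ : NonZero D}} where

  shift : (f : Form D) → Form.a f ℕ.< Form.b f →
          ∃ λ (g : Form D) → size g ℕ.< size f × values f ⊆ values g
  shift (mkForm zero b c disc) _ =
    contradiction (ℕ.m+n≡0⇒n≡0 (b ℕ.* b) (disc-ℕ (mkForm 0 b c disc))) (ℕ.≢-nonZero⁻¹ D)
  shift (mkForm a@(suc _) b c disc) a<b =
    mkForm a ∣ β ∣ ∣ γ ∣ disc′ , ℕ.+-monoʳ-< a (∣b-2a∣<b ℕ.z<s a<b) , transfer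
    where
    β = + b - (+ a + + a)
    γ = + a - + b + + c
    discβγ : β * β + + D ≡ + 4 * (+ a * γ)
    discβγ = disc-shift (+ a) (+ b) (+ c) (+ D) disc
    γ≡∣γ∣ : γ ≡ + ∣ γ ∣
    γ≡∣γ∣ = nonneg-factor (ℕ.pred (4 ℕ.* a)) γ (begin
      + (∣ β ∣ ℕ.* ∣ β ∣ ℕ.+ D)   ≡⟨ pos-sq+ ∣ β ∣ D ⟩
      + ∣ β ∣ * + ∣ β ∣ + + D     ≡⟨ cong (_+ + D) (abs-sq β) ⟩
      β * β + + D                 ≡⟨ discβγ ⟩
      + 4 * (+ a * γ)             ≡⟨ ℤ.*-assoc (+ 4) (+ a) γ ⟨
      + 4 * + a * γ               ∎)
      where open ≡-Reasoning
    disc′ : + ∣ β ∣ * + ∣ β ∣ + + D ≡ + 4 * (+ a * + ∣ γ ∣)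
    disc′ = trans (cong (_+ + D) (abs-sq β)) (trans discβγ (cong (λ x → + 4 * (+ a * x)) γ≡∣γ∣))
    transfer : values (mkForm a b c disc) ⊆ values (mkForm a ∣ β ∣ ∣ γ ∣ disc′)
    transfer (u , v , n≡) with form-abs-middle (+ a) β γ (u + v) v
    ... | v′ , flip = u + v , v′ , (begin
      _                                     ≡⟨ n≡ ⟩
      form (+ a) (+ b) (+ c) u v            ≡⟨ form-shift (+ a) (+ b) (+ c) u v ⟩
      form (+ a) β γ (u + v) v              ≡⟨ flip ⟩
      form (+ a) (+ ∣ β ∣) γ (u + v) v′     ≡⟨ cong (λ x → form (+ a) (+ ∣ β ∣) x (u + v) v′) γ≡∣γ∣ ⟩
      form (+ a) (+ ∣ β ∣) (+ ∣ γ ∣) (u + v) v′ ∎)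
      where open ≡-Reasoning

  reduction-step : (f : Form D) → Reduced f ⊎ ∃ λ (g : Form D) → size g ℕ.< size f × values f ⊆ values g
  reduction-step f@(mkForm a b c _) with b ℕ.≤? a | a ℕ.≤? c
  ... | yes b≤a | yes a≤c = inj₁ (b≤a , a≤c)
  ... | yes _   | no a≰c  = inj₂ (swap f , ℕ.+-monoˡ-< b (ℕ.≰⇒> a≰c) , values-swap f)
  ... | no b≰a  | _       = inj₂ (shift f (ℕ.≰⇒> b≰a))

  reduce : (f : Form D) → ∃ λ (g : Form D) → Reduced g × values f ⊆ values g
  reduce f = reduce-below (suc (size f)) f ℕ.≤-refl
    where
    reduce-below : ∀ n (f : Form D) → size f ℕ.< n → ∃ λ (g : Form D) → Reduced g × values f ⊆ values g
    reduce-below (suc n) f (s≤s size≤n) with reduction-step f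
    ... | inj₁ reduced = f , reduced , λ n∈f → n∈f
    ... | inj₂ (g , g<f , f⊆g) with reduce-below n g (ℕ.<-≤-trans g<f size≤n)
    ...   | h , reduced , g⊆h = h , reduced , λ n∈f → g⊆h (f⊆g n∈f)

principal-7 : Form 7
principal-7 = mkForm 1 1 2 refl

reduced-disc-7 : ∀ a b c → b ℕ.≤ a → a ℕ.≤ c → b ℕ.* b ℕ.+ 7 ≡ 4 ℕ.* (a ℕ.* c) →
                 a ≡ 1 × b ≡ 1 × c ≡ 2
reduced-disc-7 0 0 _ _ _ ()
reduced-disc-7 1 0 c _ _ disc = contradiction (trans (cong (_% 4) disc) 4∣4c) λ ()
  where
  4∣4c : 4 ℕ.* (1 ℕ.* c) % 4 ≡ 0
  4∣4c = trans (cong (_% 4) (ℕ.*-comm 4 (1 ℕ.* c))) (m*n%n≡0 (1 ℕ.* c) 4)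
reduced-disc-7 1 1 c _ _ disc =
  refl , refl , sym (ℕ.*-cancelˡ-≡ 2 c 4 (trans disc (cong (4 ℕ.*_) (ℕ.*-identityˡ c))))
reduced-disc-7 1 (suc (suc _)) _ (s≤s ()) _ _
reduced-disc-7 (suc (suc a)) b c b≤A A≤c disc = contradiction 12≤7 (ℕ.<⇒≱ (ℕ.m≤m+n 8 4))
  where
  open ℕ.≤-Reasoning
  A = suc (suc a)
  3A²≤7 : 3 ℕ.* (A ℕ.* A) ℕ.≤ 7
  3A²≤7 = ℕ.+-cancelˡ-≤ (A ℕ.* A) (3 ℕ.* (A ℕ.* A)) 7 (begin
    4 ℕ.* (A ℕ.* A)   ≤⟨ ℕ.*-monoʳ-≤ 4 (ℕ.*-monoʳ-≤ A A≤c) ⟩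
    4 ℕ.* (A ℕ.* c)   ≡⟨ disc ⟨
    b ℕ.* b ℕ.+ 7     ≤⟨ ℕ.+-monoˡ-≤ 7 (ℕ.*-mono-≤ b≤A b≤A) ⟩
    A ℕ.* A ℕ.+ 7     ∎)
  12≤7 : 12 ℕ.≤ 7
  12≤7 = begin
    3 ℕ.* (2 ℕ.* 2)   ≤⟨ ℕ.*-monoʳ-≤ 3 (ℕ.*-mono-≤ {2} {A} {2} {A} (s≤s (s≤s z≤n)) (s≤s (s≤s z≤n))) ⟩
    3 ℕ.* (A ℕ.* A)   ≤⟨ 3A²≤7 ⟩
    7                 ∎

reduced⇒principal-7 : (f : Form 7) → Reduced f → values f ⊆ values principal-7
reduced⇒principal-7 (mkForm a b c disc) (b≤a , a≤c) with reduced-disc-7 a b c b≤a a≤c (disc-ℕ (mkForm a b c disc))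
... | refl , refl , refl = λ n∈f → n∈f

splitting-form : ∀ {d p} → + 4 * cK d ≡ + 1 + + d → Splits d p → Σ (Form d) λ f → values f (+ p)
splitting-form {d} {p} 4c≡1+d (x , divides q ∣y∣≡qp , _) =
  mkForm p B q disc , + 1 , + 0 , at-1-0 (+ p) (+ B) (+ q)
  where
  open ≡-Reasoning
  y = x * x - x + cK d
  B = ∣ + 2 * x - + 1 ∣
  complete-square : ∀ x k → + 4 * (x * x - x + k) ≡ (+ 2 * x - + 1) * (+ 2 * x - + 1) + (+ 4 * k - + 1)
  complete-square = solve-∀
  cancel : ∀ z d → z + (+ 1 + d - + 1) ≡ z + d
  cancel = solve-∀
  at-1-0 : ∀ P B Q → P ≡ P * (+ 1 * + 1) + B * (+ 1 * + 0) + Q * (+ 0 * + 0)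
  at-1-0 = solve-∀
  4y≡ : + 4 * y ≡ + B * + B + + d
  4y≡ = begin
    + 4 * y                                                ≡⟨ complete-square x (cK d) ⟩
    (+ 2 * x - + 1) * (+ 2 * x - + 1) + (+ 4 * cK d - + 1) ≡⟨ cong (λ z → (+ 2 * x - + 1) * (+ 2 * x - + 1) + (z - + 1)) 4c≡1+d ⟩
    (+ 2 * x - + 1) * (+ 2 * x - + 1) + (+ 1 + + d - + 1)  ≡⟨ cancel ((+ 2 * x - + 1) * (+ 2 * x - + 1)) (+ d) ⟩
    (+ 2 * x - + 1) * (+ 2 * x - + 1) + + d                ≡⟨ cong (_+ + d) (abs-sq (+ 2 * x - + 1)) ⟨
    + B * + B + + d                                        ∎
  y≡qp : y ≡ + (q ℕ.* p)
  y≡qp = trans (nonneg-factor 3 y (trans (pos-sq+ B d) (sym 4y≡))) (cong +_ ∣y∣≡qp)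
  disc : + B * + B + + d ≡ + 4 * (+ p * + q)
  disc = begin
    + B * + B + + d     ≡⟨ 4y≡ ⟨
    + 4 * y             ≡⟨ cong (+ 4 *_) y≡qp ⟩
    + 4 * + (q ℕ.* p)   ≡⟨ cong (+ 4 *_) (trans (ℤ.pos-* q p) (ℤ.*-comm (+ q) (+ p))) ⟩
    + 4 * (+ p * + q)   ∎

splits⇒norm-7 : ∀ {p} → Splits 7 p → ∃ λ π → norm 7 π ≡ + p
splits⇒norm-7 sp with splitting-form refl sp
... | f , p∈f with reduce f
... | g , reduced , f⊆g with reduced⇒principal-7 g reduced (f⊆g p∈f)
... | u , v , p≡ = u + v ω , sym p≡

-- Residues modulo 2 and 4

divModℕ : ∀ (x : ℤ) n .{{_ : NonZero n}} → ∃₂ λ r s → r ℕ.< n × x ≡ + r + s * + n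
divModℕ x n = x %ℕ n , x /ℕ n , n%ℕd<d x n , a≡a%ℕn+[a/ℕn]*n x n

%-residue⁺ : ∀ {p n} .{{_ : NonZero n}} k e → + p ≡ + k + + e * + n → p % n ≡ k % n
%-residue⁺ {p} {n} k e p≡ =
  trans (cong (_% n) (ℤ.+-injective (trans p≡ k+en≡))) ([m+kn]%n≡m%n k e n)
  where
  k+en≡ : + k + + e * + n ≡ + (k ℕ.+ e ℕ.* n)
  k+en≡ = trans (cong (λ x → + k + x) (sym (ℤ.pos-* e n))) (sym (ℤ.pos-+ k (e ℕ.* n)))

%-residue : ∀ {p n} .{{_ : NonZero n}} k E → + p ≡ + k + E * + n → p % n ≡ k % n
%-residue k (+ e) p≡ = %-residue⁺ k e p≡
%-residue {p} {n} k -[1+ e ] p≡ =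
  sym (%-residue⁺ p (suc e) (trans (move (+ k) -[1+ e ] (+ n)) (cong (_+ + suc e * + n) (sym p≡))))
  where
  move : ∀ k E n → k ≡ (k + E * n) + (- E) * n
  move = solve-∀

residue-≡1 : ∀ {p n} .{{_ : NonZero n}} k E → + p ≡ + k + E * + n → p % n ≡ 1 → k % n ≡ 1
residue-≡1 k E p≡ p≡1 = trans (sym (%-residue k E p≡)) p≡1

r²+rt≡1[2]⇒t≡0 : ∀ {p} r t E → r ℕ.< 2 → t ℕ.< 2 →
                  + p ≡ (+ r * + r + + r * + t) + E * + 2 → p % 2 ≡ 1 → t ≡ 0
r²+rt≡1[2]⇒t≡0 r 0 E _ _ _ _ = refl
r²+rt≡1[2]⇒t≡0 0 1 E _ _ p≡ p-odd = contradiction (residue-≡1 0 E p≡ p-odd) λ ()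
r²+rt≡1[2]⇒t≡0 1 1 E _ _ p≡ p-odd = contradiction (residue-≡1 2 E p≡ p-odd) λ ()
r²+rt≡1[2]⇒t≡0 (suc (suc _)) 1 E (s≤s (s≤s ())) _ _ _
r²+rt≡1[2]⇒t≡0 _ (suc (suc _)) E _ (s≤s (s≤s ())) _ _

odd-norm⇒even-om : ∀ {p} c k a b → c ≡ + 2 * k → + p ≡ form (+ 1) (+ 1) c a b → p % 2 ≡ 1 →
                   ∃ λ β → b ≡ + 2 * β
odd-norm⇒even-om _ k a b refl p≡ p-odd with divModℕ a 2 | divModℕ b 2
... | r , s , r<2 , refl | t , w , t<2 , refl
  with r²+rt≡1[2]⇒t≡0 r t (quotient (+ r) s (+ t) w k) r<2 t<2
                       (trans p≡ (expand (+ r) s (+ t) w k)) p-odd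
  where
  quotient : ℤ → ℤ → ℤ → ℤ → ℤ → ℤ
  quotient r s t w k = + 2 * (r * s) + + 2 * (s * s) + r * w + s * t + + 2 * (s * w)
                       + k * ((t + w * + 2) * (t + w * + 2))
  expand : ∀ r s t w k →
    + 1 * ((r + s * + 2) * (r + s * + 2)) + + 1 * ((r + s * + 2) * (t + w * + 2))
      + + 2 * k * ((t + w * + 2) * (t + w * + 2))
    ≡ (r * r + r * t) + (+ 2 * (r * s) + + 2 * (s * s) + r * w + s * t + + 2 * (s * w)
                         + k * ((t + w * + 2) * (t + w * + 2))) * + 2
  expand = solve-∀
... | refl = w , even w
  where
  even : ∀ w → + 0 + w * + 2 ≡ + 2 * w
  even = solve-∀

r²+2rt≡1[4]⇒t≡0×r≡±1 : ∀ {p} r t E → r ℕ.< 4 → t ℕ.< 2 →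
                + p ≡ (+ r * + r + + 2 * (+ r * + t)) + E * + 4 → p % 4 ≡ 1 →
                t ≡ 0 × (r ≡ 1 ⊎ r ≡ 3)
r²+2rt≡1[4]⇒t≡0×r≡±1 1 0 _ _ _ _ _ = refl , inj₁ refl
r²+2rt≡1[4]⇒t≡0×r≡±1 3 0 _ _ _ _ _ = refl , inj₂ refl
r²+2rt≡1[4]⇒t≡0×r≡±1 0 0 E _ _ p≡ p≡1 = contradiction (residue-≡1 0 E p≡ p≡1) λ ()
r²+2rt≡1[4]⇒t≡0×r≡±1 2 0 E _ _ p≡ p≡1 = contradiction (residue-≡1 4 E p≡ p≡1) λ ()
r²+2rt≡1[4]⇒t≡0×r≡±1 0 1 E _ _ p≡ p≡1 = contradiction (residue-≡1 0 E p≡ p≡1) λ ()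
r²+2rt≡1[4]⇒t≡0×r≡±1 1 1 E _ _ p≡ p≡1 = contradiction (residue-≡1 3 E p≡ p≡1) λ ()
r²+2rt≡1[4]⇒t≡0×r≡±1 2 1 E _ _ p≡ p≡1 = contradiction (residue-≡1 8 E p≡ p≡1) λ ()
r²+2rt≡1[4]⇒t≡0×r≡±1 3 1 E _ _ p≡ p≡1 = contradiction (residue-≡1 15 E p≡ p≡1) λ ()
r²+2rt≡1[4]⇒t≡0×r≡±1 (suc (suc (suc (suc _)))) _ _ (s≤s (s≤s (s≤s (s≤s ())))) _ _ _
r²+2rt≡1[4]⇒t≡0×r≡±1 _ (suc (suc _)) _ _ (s≤s (s≤s ())) _ _

%4≡1⇒%2≡1 : ∀ {p} → p % 4 ≡ 1 → p % 2 ≡ 1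
%4≡1⇒%2≡1 {p} p≡1 = trans (sym (m∣n⇒o%n%m≡o%m 2 4 p (divides 2 refl))) (cong (_% 2) p≡1)

SpecialFactorisation : ℕ → ℕ → Set
SpecialFactorisation d p = ∃ λ π → ι (+ p) ≡ mul d π (conj π) × CongO d π (ι (+ 1)) (ι (+ 4))

EvenTraceFactorisation : ℕ → ℕ → Set
EvenTraceFactorisation d p =
  ∃ λ π → ι (+ p) ≡ mul d π (conj π) × CongO d (π ⊕ conj π) (ι (+ 0)) (ι (+ 2))

even-om⇒special : ∀ d p π β → norm d π ≡ + p → om π ≡ + 2 * β → p % 4 ≡ 1 →
                    SpecialFactorisation d p
even-om⇒special d p π@(a + b ω) β n≡p refl p≡1 with divModℕ a 4 | divModℕ β 2
... | r , s , r<4 , refl | t , w , t<2 , refl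
  with r²+2rt≡1[4]⇒t≡0×r≡±1 r t (quotient (+ r) s (+ t) w (cK d)) r<4 t<2
                     (trans (sym n≡p) (expand (+ r) s (+ t) w (cK d))) p≡1
  where
  quotient : ℤ → ℤ → ℤ → ℤ → ℤ → ℤ
  quotient r s t w k = + 2 * (r * s) + + 4 * (s * s) + r * w + + 2 * (s * t)
                       + + 4 * (s * w) + k * ((t + w * + 2) * (t + w * + 2))
  expand : ∀ r s t w k →
    + 1 * ((r + s * + 4) * (r + s * + 4)) + + 1 * ((r + s * + 4) * (+ 2 * (t + w * + 2)))
      + k * (+ 2 * (t + w * + 2) * (+ 2 * (t + w * + 2)))
    ≡ (r * r + + 2 * (r * t)) + (+ 2 * (r * s) + + 4 * (s * s) + r * w + + 2 * (s * t)
                                 + + 4 * (s * w) + k * ((t + w * + 2) * (t + w * + 2))) * + 4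
  expand = solve-∀
... | refl , inj₁ refl =
  π , norm⇒mul-conj d p π n≡p , congO-ι d π (ι (+ 1)) (+ 4) s w (re≡ s) (om≡ w)
  where
  re≡ : ∀ s → (+ 1 + s * + 4) - + 1 ≡ + 4 * s
  re≡ = solve-∀
  om≡ : ∀ w → + 2 * (+ 0 + w * + 2) - + 0 ≡ + 4 * w
  om≡ = solve-∀
... | refl , inj₂ refl =
  π′ , norm⇒mul-conj d p π′ (trans (norm-neg d a b) n≡p) ,
  congO-ι d π′ (ι (+ 1)) (+ 4) (- s - + 1) (- w) (re≡ s) (om≡ w)
  where
  π′ = (- a) + (- b) ω
  re≡ : ∀ s → - (+ 3 + s * + 4) - + 1 ≡ + 4 * (- s - + 1)
  re≡ = solve-∀
  om≡ : ∀ w → - (+ 2 * (+ 0 + w * + 2)) - + 0 ≡ + 4 * (- w)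
  om≡ = solve-∀

special⇒even-trace : ∀ {d p} → SpecialFactorisation d p → EvenTraceFactorisation d p
special⇒even-trace {d} (π@(a + b ω) , p≡ , π≡1) with congO-ι⁻¹ d π (ι (+ 1)) (+ 4) π≡1
... | _ , y , _ , b≡ =
  π , p≡ , congO-ι d (π ⊕ conj π) (ι (+ 0)) (+ 2) (a + + 2 * y) (+ 0) trace≡ (om≡ b)
  where
  twice : ∀ a y → (a + (a + + 4 * y)) - + 0 ≡ + 2 * (a + + 2 * y)
  twice = solve-∀
  trace≡ : (a + (a + b)) - + 0 ≡ + 2 * (a + + 2 * y)
  trace≡ = trans (cong (λ b → (a + (a + b)) - + 0) (trans (sym (ℤ.+-identityʳ b)) b≡)) (twice a y)
  om≡ : ∀ b → (b + - b) - + 0 ≡ + 2 * + 0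
  om≡ = solve-∀

even-trace⇒special : ∀ {d p} → p % 4 ≡ 1 → EvenTraceFactorisation d p → SpecialFactorisation d p
even-trace⇒special {d} {p} p≡1 (π@(a + b ω) , p≡ , trace≡)
  with congO-ι⁻¹ d (π ⊕ conj π) (ι (+ 0)) (+ 2) trace≡
... | x , _ , trace≡2x , _ =
  even-om⇒special d p π (x - a) (mul-conj⇒norm d p π p≡) b≡2[x-a] p≡1
  where
  isolate : ∀ a b → b ≡ ((a + (a + b)) - + 0) - + 2 * a
  isolate = solve-∀
  halve : ∀ a x → + 2 * x - + 2 * a ≡ + 2 * (x - a)
  halve = solve-∀
  b≡2[x-a] : b ≡ + 2 * (x - a)
  b≡2[x-a] = trans (isolate a b) (trans (cong (_- + 2 * a) trace≡2x) (halve a x))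

special-split⇔even-trace : ∀ {d p} → Splits d p → p % 4 ≡ 1 →
                           SpecialSplit d p ⇔ EvenTraceFactorisation d p
special-split⇔even-trace {d} {p} sp p≡1 =
  mk⇔ (λ (_ , special) → special⇒even-trace {d} {p} special)
      (λ even → sp , even-trace⇒special {d} {p} p≡1 even)

special-split-7 : ∀ {p} → Splits 7 p → p % 4 ≡ 1 → SpecialSplit 7 p
special-split-7 {p} sp p≡1 =
  let π , n≡p = splits⇒norm-7 sp
      β , om≡ = odd-norm⇒even-om {p} (cK 7) (+ 1) (re π) (om π) refl (sym n≡p) (%4≡1⇒%2≡1 {p} p≡1)
  in sp , even-om⇒special 7 p π β n≡p om≡ p≡1

lemma4p2 : ((p : ℕ) → Prime p → Splits 7 p → p % 4 ≡ 1 → SpecialSplit 7 p)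
    × ((q : ℕ) → q ∈ (11 ∷ 19 ∷ 43 ∷ 67 ∷ 163 ∷ []) →
    (p : ℕ) → Prime p → Splits q p → p % 4 ≡ 1 →
    (SpecialSplit q p ⇔
    (∃ λ (π : O) → ι (+ p) ≡ mul q π (conj π)
    × CongO q (π ⊕ conj π) (ι (+ 0)) (ι (+ 2)))))
lemma4p2 = (λ p _ → special-split-7 {p}) , λ q _ p _ → special-split⇔even-trace {q} {p}
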